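{- For every integer $n\ge 2$, the sequence of iterates $n, B_1(n), B_1^2(n),\dots$ is eventually periodic, and the only cycles of $B_1$ on the integers $\ge 2$ are $(4)$ (the fixed point $B_1(4)=4$) and $(5,6)$ (with $B_1(5)=6$, $B_1(6)=5$).
   Context: For an integer $n\ge 2$ with prime factorization $n=p_1^{r_1}\cdots p_k^{r_k}$, let $B(n)=\sum_{i=1}^k r_ip_i$. Define $B_1(n)=n+1$ if $n$ is prime and $B_1(n)=B(n)$ otherwise; $B_1^k$ denotes the $k$-fold iterate. A point $m$ is periodic if $B_1^l(m)=m$ for some $l\ge1$; a cycle is the orbit of a periodic point; a sequence is eventually periodic if some iterate is a periodic point. -}

module Defs where

open import Data.Nat using (ℕ; zero; suc; _+_; NonZero)
open import Data.Nat.ListAction using (sum)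
open import Data.Nat.Primality using (prime?)
open import Data.Nat.Primality.Factorisation using (factorise; factors)
open import Data.Bool using (if_then_else_)
open import Relation.Nullary using (does)
open import Data.Product using (Σ; _×_)
open import Relation.Binary.PropositionalEquality using (_≡_)
open import Data.Nat using (_≤_)

-- B(n) = Σ rᵢ pᵢ for n = Π pᵢ^rᵢ : the sum of the prime factors of n
-- counted with multiplicity (stdlib prime factorisation, unique up to ↭).
B : (n : ℕ) → .{{NonZero n}} → ℕ
B n = sum (factors (factorise n))

-- B₁(n) = n + 1 if n is prime, B(n) otherwise.
-- Only meaningful for n ≥ 2; we set B₁ 0 = 0 (B₁ 1 = B 1 = 0 by the
-- definition; irrelevant, as the statement only concerns n ≥ 2).
B₁ : ℕ → ℕ
B₁ zero = zero
B₁ n@(suc _) = if does (prime? n) then suc n else B n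

B₁^ : ℕ → ℕ → ℕ
B₁^ zero m = m
B₁^ (suc k) m = B₁ (B₁^ k m)

Periodic : ℕ → Set
Periodic m = Σ ℕ λ l → (1 ≤ l) × (B₁^ l m ≡ m)

EventuallyPeriodic : ℕ → Set
EventuallyPeriodic n = Σ ℕ λ k → Periodic (B₁^ k n)

-- Composite n = p₁⋯p_r (r ≥ 2) has 2·B(n) ≤ n + 4, because 2(a + b) ≤ 4 + ab for
-- a, b ≥ 2. Hence for n ≥ 7, B₁ strictly decreases n when n is composite, and
-- B₁² does when n is prime (n + 1 is then even, so composite). Every orbit
-- thus drops into {2, …, 6}, where 2 ↦ 3 ↦ 4 ↦ 4 and 5 ↦ 6 ↦ 5; and a
-- periodic point lies on the orbit of each of its iterates, so on {4, 5, 6}.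
{-# OPTIONS --safe #-}
module Submission where

open import Defs
open import Data.Nat
open import Data.Nat.Properties
open import Data.Nat.Induction using (<-rec)
open import Data.Nat.Tactic.RingSolver using (solve-∀)
open import Data.Nat.Divisibility using (_∣_; divides)
open import Data.Nat.ListAction using (sum; product)
open import Data.Nat.Primality using (Prime; prime?; composite; prime⇒nonTrivial)
open import Data.Nat.Primality.Factorisation using (factorise; PrimeFactorisation)
open import Data.List using ([]; _∷_)
open import Data.List.Relation.Unary.All as All using (All; []; _∷_)
open import Data.Product using (_×_; _,_; ∃-syntax; map₂)
open import Data.Sum using (_⊎_; inj₁; inj₂)
open import Data.Empty using (⊥-elim)
open import Relation.Nullary using (¬_; yes; no)
open import Relation.Binary.PropositionalEquality
  using (_≡_; refl; sym; trans; cong; subst; module ≡-Reasoning)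

m+n≤m*n : ∀ {m n} → 2 ≤ m → 2 ≤ n → m + n ≤ m * n
m+n≤m*n {2+ i} {2+ j} (s≤s (s≤s _)) (s≤s (s≤s _)) =
  subst (2 + i + (2 + j) ≤_) (sym (identity i j)) (m≤m+n _ _)
  where
  identity : ∀ i j → (2 + i) * (2 + j) ≡ (2 + i + (2 + j)) + (i + j + i * j)
  identity = solve-∀

2*[m+n]≤4+m*n : ∀ {m n} → 2 ≤ m → 2 ≤ n → 2 * (m + n) ≤ 4 + m * n
2*[m+n]≤4+m*n {2+ i} {2+ j} (s≤s (s≤s _)) (s≤s (s≤s _)) =
  subst (2 * (2 + i + (2 + j)) ≤_) (sym (identity i j)) (m≤m+n _ _)
  where
  identity : ∀ i j → 4 + (2 + i) * (2 + j) ≡ 2 * (2 + i + (2 + j)) + i * j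
  identity = solve-∀

half-< : ∀ {b k n} → 2 * b ≤ k + n → k < n → b < n
half-< {b} {k} {n} 2b≤k+n k<n = *-cancelˡ-< 2 b n (begin-strict
  2 * b        ≤⟨ 2b≤k+n ⟩
  k + n        <⟨ +-monoˡ-< n k<n ⟩
  n + n        ≡⟨ cong (n +_) (+-identityʳ n) ⟨
  2 * n        ∎)
  where open ≤-Reasoning

2≤product : ∀ {x xs} → All (2 ≤_) (x ∷ xs) → 2 ≤ product (x ∷ xs)
2≤product {x} (2≤x ∷ []) = ≤-trans 2≤x (≤-reflexive (sym (*-identityʳ x)))
2≤product {x} (2≤x ∷ 2≤ys@(_ ∷ _)) =
  ≤-trans 2≤x (≤-trans (m≤m+n x _) (m+n≤m*n 2≤x (2≤product 2≤ys)))

sum≤product : ∀ {xs} → All (2 ≤_) xs → sum xs ≤ product xs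
sum≤product [] = z≤n
sum≤product {x ∷ []} (_ ∷ []) = ≤-reflexive (trans (+-identityʳ x) (sym (*-identityʳ x)))
sum≤product {x ∷ _ ∷ _} (2≤x ∷ 2≤ys) =
  ≤-trans (+-monoʳ-≤ x (sum≤product 2≤ys)) (m+n≤m*n 2≤x (2≤product 2≤ys))

2*sum≤4+product : ∀ {x y zs} → All (2 ≤_) (x ∷ y ∷ zs) →
                  2 * sum (x ∷ y ∷ zs) ≤ 4 + product (x ∷ y ∷ zs)
2*sum≤4+product {x} (2≤x ∷ 2≤ys) =
  ≤-trans (*-monoʳ-≤ 2 (+-monoʳ-≤ x (sum≤product 2≤ys))) (2*[m+n]≤4+m*n 2≤x (2≤product 2≤ys))

prime⇒2≤ : ∀ {p} → Prime p → 2 ≤ p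
prime⇒2≤ {p} pr = nonTrivial⇒n>1 p {{prime⇒nonTrivial pr}}

2∣n⊎2∣1+n : ∀ n → 2 ∣ n ⊎ 2 ∣ suc n
2∣n⊎2∣1+n zero = inj₁ (divides 0 refl)
2∣n⊎2∣1+n (suc n) with 2∣n⊎2∣1+n n
... | inj₁ (divides q n≡q*2) = inj₂ (divides (suc q) (cong (2 +_) n≡q*2))
... | inj₂ 2∣1+n = inj₁ 2∣1+n

prime⇒¬prime[1+] : ∀ {p} → Prime p → 3 ≤ p → ¬ Prime (suc p)
prime⇒¬prime[1+] {p} pr 3≤p pr[1+p] with 2∣n⊎2∣1+n p
... | inj₁ 2∣p   = Prime.notComposite pr (composite 3≤p 2∣p)
... | inj₂ 2∣1+p = Prime.notComposite pr[1+p] (composite (m≤n⇒m≤1+n 3≤p) 2∣1+p)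

2≤sum-of-primes : ∀ {n xs} → All Prime xs → n ≡ product xs → 2 ≤ n → 2 ≤ sum xs
2≤sum-of-primes {xs = []} _ refl (s≤s ())
2≤sum-of-primes {xs = x ∷ _} (px ∷ _) _ _ = ≤-trans (prime⇒2≤ px) (m≤m+n x _)

2*sum-of-primes≤4+n : ∀ {n xs} → All Prime xs → n ≡ product xs → 2 ≤ n → ¬ Prime n →
                      2 * sum xs ≤ 4 + n
2*sum-of-primes≤4+n {xs = []} _ refl (s≤s ()) _
2*sum-of-primes≤4+n {xs = x ∷ []} (px ∷ []) refl _ ¬pn =
  ⊥-elim (¬pn (subst Prime (sym (*-identityʳ x)) px))
2*sum-of-primes≤4+n {xs = _ ∷ _ ∷ _} ps refl _ _ = 2*sum≤4+product (All.map prime⇒2≤ ps)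

module _ (n : ℕ) .{{_ : NonZero n}} (2≤n : 2 ≤ n) where
  open PrimeFactorisation (factorise n)

  2≤B : 2 ≤ B n
  2≤B = 2≤sum-of-primes factorsPrime isFactorisation 2≤n

  2*B≤4+n : ¬ Prime n → 2 * B n ≤ 4 + n
  2*B≤4+n = 2*sum-of-primes≤4+n factorsPrime isFactorisation 2≤n

B₁-prime : ∀ {n} → Prime n → B₁ n ≡ suc n
B₁-prime {suc k} pr with prime? (suc k)
... | yes _  = refl
... | no ¬pr = ⊥-elim (¬pr pr)

B₁-¬prime : ∀ k → ¬ Prime (suc k) → B₁ (suc k) ≡ B (suc k)
B₁-¬prime k ¬pr with prime? (suc k)
... | yes pr = ⊥-elim (¬pr pr)
... | no _   = refl

2≤B₁ : ∀ {n} → 2 ≤ n → 2 ≤ B₁ n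
2≤B₁ {n@(suc k)} 2≤n with prime? n
... | yes _ = m≤n⇒m≤1+n 2≤n
... | no _  = 2≤B n 2≤n

2≤B₁^ : ∀ j {n} → 2 ≤ n → 2 ≤ B₁^ j n
2≤B₁^ zero    2≤n = 2≤n
2≤B₁^ (suc j) 2≤n = 2≤B₁ (2≤B₁^ j 2≤n)

B₁^-+ : ∀ a b m → B₁^ (a + b) m ≡ B₁^ a (B₁^ b m)
B₁^-+ zero    b m = refl
B₁^-+ (suc a) b m = cong B₁ (B₁^-+ a b m)

B₁^-periodic : ∀ {l m} → B₁^ l m ≡ m → ∀ t → B₁^ (t * l) m ≡ m
B₁^-periodic _ zero = refl
B₁^-periodic {l} {m} period (suc t) =
  trans (B₁^-+ l (t * l) m) (trans (cong (B₁^ l) (B₁^-periodic period t)) period)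

B₁-descent : ∀ n → 7 ≤ n → ∃[ j ] B₁^ j n < n
B₁-descent n@(suc k) 7≤n with prime? n
... | yes pr = 2 , (begin-strict
  B₁ (B₁ n)   ≡⟨ cong B₁ (B₁-prime pr) ⟩
  B₁ (suc n)  ≡⟨ B₁-¬prime n ¬pr[1+n] ⟩
  B (suc n)   <⟨ half-< (2*B≤4+n (suc n) (s≤s (s≤s z≤n)) ¬pr[1+n])
                         (≤-trans (m≤m+n 6 1) 7≤n) ⟩
  n           ∎)
  where
  open ≤-Reasoning
  ¬pr[1+n] : ¬ Prime (suc n)
  ¬pr[1+n] = prime⇒¬prime[1+] pr (≤-trans (m≤m+n 3 4) 7≤n)
... | no ¬pr = 1 , (begin-strict
  B₁ n        ≡⟨ B₁-¬prime k ¬pr ⟩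
  B n         <⟨ half-< (2*B≤4+n n (≤-trans (m≤m+n 2 5) 7≤n) ¬pr)
                         (≤-trans (m≤m+n 5 2) 7≤n) ⟩
  n           ∎)
  where open ≤-Reasoning

InCycle : ℕ → Set
InCycle m = m ≡ 4 ⊎ m ≡ 5 ⊎ m ≡ 6

B₁-InCycle : ∀ {m} → InCycle m → InCycle (B₁ m)
B₁-InCycle (inj₁ refl)        = inj₁ refl
B₁-InCycle (inj₂ (inj₁ refl)) = inj₂ (inj₂ refl)
B₁-InCycle (inj₂ (inj₂ refl)) = inj₂ (inj₁ refl)

B₁^-InCycle : ∀ j {m} → InCycle m → InCycle (B₁^ j m)
B₁^-InCycle zero    c = c
B₁^-InCycle (suc j) c = B₁-InCycle (B₁^-InCycle j c)

InCycle⇒Periodic : ∀ {m} → InCycle m → Periodic m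
InCycle⇒Periodic (inj₁ refl)        = 2 , s≤s z≤n , refl
InCycle⇒Periodic (inj₂ (inj₁ refl)) = 2 , s≤s z≤n , refl
InCycle⇒Periodic (inj₂ (inj₂ refl)) = 2 , s≤s z≤n , refl

reachesCycle : ∀ n → 2 ≤ n → ∃[ K ] InCycle (B₁^ K n)
reachesCycle = <-rec (λ n → 2 ≤ n → ∃[ K ] InCycle (B₁^ K n)) reach
  where
  reach : ∀ n → (∀ {m} → m < n → 2 ≤ m → ∃[ K ] InCycle (B₁^ K m)) →
          2 ≤ n → ∃[ K ] InCycle (B₁^ K n)
  reach 0 _ ()
  reach 1 _ (s≤s ())
  reach 2 _ _ = 2 , inj₁ refl
  reach 3 _ _ = 1 , inj₁ refl
  reach 4 _ _ = 0 , inj₁ refl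
  reach 5 _ _ = 0 , inj₂ (inj₁ refl)
  reach 6 _ _ = 0 , inj₂ (inj₂ refl)
  reach n@(suc (suc (suc (suc (suc (suc (suc k))))))) rec 2≤n with B₁-descent n (m≤m+n 7 k)
  ... | j , B₁^j[n]<n with rec B₁^j[n]<n (2≤B₁^ j 2≤n)
  ... | K , cycle = K + j , subst InCycle (sym (B₁^-+ K j n)) cycle

periodic⇒InCycle : ∀ {m} → 2 ≤ m → Periodic m → InCycle m
periodic⇒InCycle {m} 2≤m (suc l , _ , period) with reachesCycle m 2≤m
... | K , cycle = subst InCycle onOrbit (B₁^-InCycle (K * l) cycle)
  where
  open ≡-Reasoning
  onOrbit : B₁^ (K * l) (B₁^ K m) ≡ m
  onOrbit = begin
    B₁^ (K * l) (B₁^ K m)  ≡⟨ B₁^-+ (K * l) K m ⟨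
    B₁^ (K * l + K) m      ≡⟨ cong (λ i → B₁^ i m) (trans (+-comm (K * l) K) (sym (*-suc K l))) ⟩
    B₁^ (K * suc l) m      ≡⟨ B₁^-periodic period K ⟩
    m                      ∎

proposition3p2 :
    ((n : ℕ) → 2 ≤ n → EventuallyPeriodic n)
    × ((m : ℕ) → 2 ≤ m → Periodic m → (m ≡ 4 ⊎ m ≡ 5 ⊎ m ≡ 6))
    × (B₁ 4 ≡ 4 × B₁ 5 ≡ 6 × B₁ 6 ≡ 5)
proposition3p2 =
  (λ n 2≤n → map₂ InCycle⇒Periodic (reachesCycle n 2≤n)) ,
  (λ m → periodic⇒InCycle) ,
  refl , refl , refl
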